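{- Let $\mathcal{D}$ be a $(v,k,\lambda)$-covering or a $(v,k,\lambda)$-packing on point set $[v]=\{1,\dots,v\}$. Then $\mathcal{D}$ has at least $\operatorname{rank}(M^*(\mathcal{D}))$ blocks.
   Context: A $(v,k,\lambda)$-covering (resp. packing) is a pair $([v],\mathcal{B})$ where $\mathcal{B}$ is a collection of $k$-subsets of $[v]$ (blocks) such that every pair of distinct points lies together in at least (resp. at most) $\lambda$ blocks. For $u\in[v]$ let $r_{\mathcal{D}}(u)$ be the number of blocks containing $u$, and for distinct $u,w$ let $r_{\mathcal{D}}(uw)$ be the number of blocks containing both. Let $G$ be the loopless multigraph on $[v]$ in which the edge $uw$ has multiplicity $\mu_G(uw)=|r_{\mathcal{D}}(uw)-\lambda|$ (called the excess if $\mathcal{D}$ is a covering, the leave if a packing), and let $A(G)$ be its adjacency matrix ($uw$ entry $\mu_G(uw)$ for $u\ne w$, $0$ on the diagonal). Let $R=\operatorname{diag}(r_{\mathcal{D}}(1)-\lambda,\dots,r_{\mathcal{D}}(v)-\lambda)$, set $M(\mathcal{D})=R+A(G)$ if $\mathcal{D}$ is a covering and $M(\mathcal{D})=R-A(G)$ if it is a packing, and $M^*(\mathcal{D})=M(\mathcal{D})+\lambda J$, where $J$ is the $v\times v$ all-ones matrix. -}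

module Defs where

open import Data.Bool using (Bool; true; false; _∧_; if_then_else_)
open import Data.Nat as ℕ using (ℕ; zero; suc; _≤_)
open import Data.Integer as ℤ using (ℤ; +_; _-_)
open import Data.Rational as ℚ using (ℚ; 0ℚ)
open import Data.Fin using (Fin; zero; suc; _≟_)
open import Data.Fin.Subset using (Subset; ∣_∣) renaming (_∈_ to _∈ˢ_)
open import Data.Vec using (lookup)
open import Data.List using (List; []; _∷_)
open import Data.List.Membership.Propositional using (_∈_)
open import Data.Product using (_×_; Σ; _,_)
open import Relation.Nullary using (¬_; yes; no)
open import Relation.Binary.PropositionalEquality using (_≡_; _≢_)
open import Function.Definitions using (Injective)

-- Blocks are k-subsets of [v] = Fin v (0-indexed); a design is a list
-- (multiset) of blocks, so repeated blocks are allowed.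

count : ∀ {v} → (Subset v → Bool) → List (Subset v) → ℕ
count p [] = 0
count p (b ∷ B) = if p b then suc (count p B) else count p B

rep : ∀ {v} → List (Subset v) → Fin v → ℕ
rep B u = count (λ b → lookup b u) B

rep₂ : ∀ {v} → List (Subset v) → Fin v → Fin v → ℕ
rep₂ B u w = count (λ b → lookup b u ∧ lookup b w) B

data Kind : Set where
  covering packing : Kind

IsDesign : Kind → (v k lam : ℕ) → List (Subset v) → Set
IsDesign covering v k lam B =
  (∀ b → b ∈ B → ∣ b ∣ ≡ k) ×
  (∀ (u w : Fin v) → u ≢ w → lam ≤ rep₂ B u w)
IsDesign packing v k lam B =
  (∀ b → b ∈ B → ∣ b ∣ ≡ k) ×
  (∀ (u w : Fin v) → u ≢ w → rep₂ B u w ≤ lam)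

Matrix : ℕ → Set
Matrix v = Fin v → Fin v → ℤ

-- multiplicity μ_G(uw) = |r_D(uw) - λ| of the excess / leave graph G
μ : ∀ {v} → ℕ → List (Subset v) → Fin v → Fin v → ℕ
μ lam B u w = ℤ.∣ + rep₂ B u w - + lam ∣

Rmat : ∀ {v} → ℕ → List (Subset v) → Matrix v
Rmat lam B u w with u ≟ w
... | yes _ = + rep B u - + lam
... | no _  = + 0

Adj : ∀ {v} → ℕ → List (Subset v) → Matrix v
Adj lam B u w with u ≟ w
... | yes _ = + 0
... | no _  = + μ lam B u w

M : ∀ {v} → Kind → ℕ → List (Subset v) → Matrix v
M covering lam B u w = Rmat lam B u w ℤ.+ Adj lam B u w
M packing  lam B u w = Rmat lam B u w - Adj lam B u w

Mstar : ∀ {v} → Kind → ℕ → List (Subset v) → Matrix v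
Mstar K lam B u w = M K lam B u w ℤ.+ + lam

-- rank over ℚ (integer matrices: same as rank over ℝ)

Σ[_] : ∀ {m} → (Fin m → ℚ) → ℚ
Σ[_] {zero} f = 0ℚ
Σ[_] {suc m} f = f zero ℚ.+ Σ[ (λ i → f (suc i)) ]

toℚ : ℤ → ℚ
toℚ z = z ℚ./ 1

IndepCols : ∀ {v m} → Matrix v → (Fin m → Fin v) → Set
IndepCols {v} {m} A cols =
  Injective _≡_ _≡_ cols ×
  (∀ (c : Fin m → ℚ) →
     (∀ (i : Fin v) → Σ[ (λ j → c j ℚ.* toℚ (A i (cols j))) ] ≡ 0ℚ) →
     ∀ j → c j ≡ 0ℚ)

IsRank : ∀ {v} → Matrix v → ℕ → Set
IsRank {v} A r =
  Σ (Fin r → Fin v) (λ cols → IndepCols A cols) ×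
  (∀ m (cols : Fin m → Fin v) → IndepCols A cols → m ≤ r)

module Submission where

-- Let N be the incidence matrix of the design: N t u = 1 if
-- point u lies in block t and 0 otherwise (t ranges over the b blocks).
-- The (u,w) entry of NᵀN is the number of blocks containing u and w, i.e.
-- r_D(uw) for u ≠ w and r_D(u) on the diagonal.  Subtracting λ from the
-- diagonal of NᵀN and replacing r_D(uw) - λ by ±μ_G(uw) off the diagonal
-- gives M(D); the covering/packing condition fixes the sign of
-- r_D(uw) - λ, so adding λJ back recovers exactly M*(D) = NᵀN.  A matrix
-- that factors through ℚ^b has at most b independent columns, hence
-- rank M*(D) ≤ b.

open import Defs
open import Data.Nat using (ℕ; _≤_)
open import Data.List using (List; length)
open import Data.Fin.Subset using (Subset)

open import Data.Nat using (zero; suc; _<_; s≤s)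
import Data.Nat.Properties as ℕP
open import Data.Integer as ℤ using (ℤ; +_; +≤+)
import Data.Integer.Properties as ℤP
open import Data.Integer.Tactic.RingSolver using (solve-∀)
open import Data.Rational using (ℚ; toℚᵘ; 0ℚ; 1ℚ; _+_; _*_; _-_; -_; 1/_; ≢-nonZero)
import Data.Rational.Properties as ℚP
import Data.Rational.Unnormalised as ℚᵘ
import Data.Rational.Unnormalised.Properties as ℚᵘP
open import Data.Fin using (Fin; zero; suc; punchIn; punchOut; _≟_)
open import Data.Fin.Properties using (all?; ¬∀⟶∃¬; punchIn-punchOut)
open import Data.Bool using (Bool; true; false; _∧_; if_then_else_)
open import Data.Bool.Properties using (∧-idem)
open import Data.Vec using (lookup)
open import Data.Vec.Functional using (replicate)
import Data.List as List
open import Data.List using ([]; _∷_)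
open import Data.Product using (_,_)
open import Data.Maybe using (nothing)
open import Relation.Nullary using (yes; no)
open import Relation.Nullary.Negation using (contradiction)
open import Relation.Binary.PropositionalEquality
open import Algebra.Bundles using (CommutativeRing)
open import Algebra.Properties.Semiring.Sum (CommutativeRing.semiring ℚP.+-*-commutativeRing)
import Tactic.RingSolver as RingSolver
open import Tactic.RingSolver.Core.AlmostCommutativeRing
  using (AlmostCommutativeRing; fromCommutativeRing)

ℚ-ring : AlmostCommutativeRing _ _
ℚ-ring = fromCommutativeRing ℚP.+-*-commutativeRing (λ _ → nothing)

Σ≡sum : ∀ {m} (f : Fin m → ℚ) → Σ[ f ] ≡ sum f
Σ≡sum {zero}  f = refl
Σ≡sum {suc m} f = cong (λ s → f zero + s) (Σ≡sum (λ i → f (suc i)))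

*-nonzero : ∀ {p q} → p ≢ 0ℚ → q ≢ 0ℚ → p * q ≢ 0ℚ
*-nonzero {p} {q} p≢0 q≢0 pq≡0 = q≢0 (begin
  q                 ≡⟨ ℚP.*-identityˡ q ⟨
  1ℚ * q            ≡⟨ cong (_* q) (ℚP.*-inverseˡ p {{≢-nonZero p≢0}}) ⟨
  p⁻¹ * p * q       ≡⟨ ℚP.*-assoc p⁻¹ p q ⟩
  p⁻¹ * (p * q)     ≡⟨ cong (p⁻¹ *_) pq≡0 ⟩
  p⁻¹ * 0ℚ          ≡⟨ ℚP.*-zeroʳ p⁻¹ ⟩
  0ℚ                ∎)
  where
  open ≡-Reasoning
  p⁻¹ = (1/ p) {{≢-nonZero p≢0}}

record NontrivialSolution {b m} (P : Fin b → Fin m → ℚ) : Set where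
  field
    coeffs    : Fin m → ℚ
    witness   : Fin m
    witness≢0 : coeffs witness ≢ 0ℚ
    solves    : ∀ t → ∑[ j < m ] (coeffs j * P t j) ≡ 0ℚ

open NontrivialSolution

first-unknown-free : ∀ {b m} (P : Fin b → Fin (suc m) → ℚ) →
  (∀ t → P t zero ≡ 0ℚ) → NontrivialSolution P
first-unknown-free {m = m} P zero-column = record
  { coeffs = e₀ ; witness = zero ; witness≢0 = λ () ; solves = solves-row }
  where
  e₀ : Fin (suc m) → ℚ
  e₀ zero    = 1ℚ
  e₀ (suc _) = 0ℚ
  solves-row : ∀ t → ∑[ j < suc m ] (e₀ j * P t j) ≡ 0ℚ
  solves-row t = begin
    1ℚ * P t zero + ∑[ j < m ] (0ℚ * P t (suc j))
      ≡⟨ cong₂ _+_ (trans (ℚP.*-identityˡ _) (zero-column t))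
                   (sum-cong-≗ (λ j → ℚP.*-zeroˡ (P t (suc j)))) ⟩
    0ℚ + sum (replicate m 0ℚ)   ≡⟨ cong (λ s → 0ℚ + s) (sum-replicate-zero m) ⟩
    0ℚ + 0ℚ                     ≡⟨ ℚP.+-identityˡ 0ℚ ⟩
    0ℚ                          ∎
    where open ≡-Reasoning

-- Gaussian elimination of the first unknown using equation t as pivot row;
-- the lifted solution is nontrivial when  pivot = P t zero  is nonzero.
module Elimination {b m} (P : Fin b → Fin (suc m) → ℚ) (t : Fin b) where

  pivot : ℚ
  pivot = P t zero

  reduced : Fin b → Fin m → ℚ
  reduced u j = pivot * P u (suc j) - P u zero * P t (suc j)

  extend : (Fin m → ℚ) → Fin (suc m) → ℚ
  extend c zero    = - ∑[ j < m ] (c j * P t (suc j))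
  extend c (suc j) = pivot * c j

  extend-row : ∀ c u →
    ∑[ j < suc m ] (extend c j * P u j) ≡ ∑[ j < m ] (c j * reduced u j)
  extend-row c u = begin
    - S * a + ∑[ j < m ] (pivot * c j * P u (suc j))
      ≡⟨ cong (λ s → - S * a + s) (trans (sum-cong-≗ (λ j → ℚP.*-assoc pivot (c j) (P u (suc j))))
                                  (sym (*-distribˡ-sum pivot (λ j → c j * P u (suc j))))) ⟩
    - S * a + pivot * T
      ≡⟨ rearrange S a pivot T ⟩
    pivot * T + - a * S
      ≡⟨ cong₂ _+_ (*-distribˡ-sum pivot (λ j → c j * P u (suc j)))
                   (*-distribˡ-sum (- a) (λ j → c j * P t (suc j))) ⟩
    ∑[ j < m ] (pivot * (c j * P u (suc j))) + ∑[ j < m ] (- a * (c j * P t (suc j)))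
      ≡⟨ sym (∑-distrib-+ (λ j → pivot * (c j * P u (suc j)))
                          (λ j → - a * (c j * P t (suc j)))) ⟩
    ∑[ j < m ] (pivot * (c j * P u (suc j)) + - a * (c j * P t (suc j)))
      ≡⟨ sum-cong-≗ (λ j → distribute (c j) pivot (P u (suc j)) a (P t (suc j))) ⟩
    ∑[ j < m ] (c j * reduced u j) ∎
    where
    open ≡-Reasoning
    a = P u zero
    S = ∑[ j < m ] (c j * P t (suc j))
    T = ∑[ j < m ] (c j * P u (suc j))
    rearrange : ∀ S a p T → - S * a + p * T ≡ p * T + - a * S
    rearrange = RingSolver.solve-∀ ℚ-ring
    distribute : ∀ c p x a y → p * (c * x) + - a * (c * y) ≡ c * (p * x - a * y)
    distribute = RingSolver.solve-∀ ℚ-ring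

  reduced-pivot-row : ∀ j → reduced t j ≡ 0ℚ
  reduced-pivot-row j = ℚP.+-inverseʳ (pivot * P t (suc j))

pivot-step : ∀ {b m} (P : Fin (suc b) → Fin (suc m) → ℚ) (t : Fin (suc b)) →
  P t zero ≢ 0ℚ →
  NontrivialSolution (λ s → Elimination.reduced P t (punchIn t s)) →
  NontrivialSolution P
pivot-step {m = m} P t pivot≢0 sol = record
  { coeffs    = extend (coeffs sol)
  ; witness   = suc (witness sol)
  ; witness≢0 = *-nonzero pivot≢0 (witness≢0 sol)
  ; solves    = solves-row
  }
  where
  open Elimination P t
  solves-row : ∀ u → ∑[ j < suc m ] (extend (coeffs sol) j * P u j) ≡ 0ℚ
  solves-row u with t ≟ u
  ... | yes refl = begin
    ∑[ j < suc m ] (extend (coeffs sol) j * P t j)   ≡⟨ extend-row (coeffs sol) t ⟩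
    ∑[ j < m ] (coeffs sol j * reduced t j)          ≡⟨ sum-cong-≗ vanishes ⟩
    sum (replicate m 0ℚ)                             ≡⟨ sum-replicate-zero m ⟩
    0ℚ                                               ∎
    where
    open ≡-Reasoning
    vanishes : ∀ j → coeffs sol j * reduced t j ≡ 0ℚ
    vanishes j = trans (cong (coeffs sol j *_) (reduced-pivot-row j)) (ℚP.*-zeroʳ (coeffs sol j))
  ... | no t≢u = trans (extend-row (coeffs sol) u)
    (subst (λ u → ∑[ j < m ] (coeffs sol j * reduced u j) ≡ 0ℚ)
           (punchIn-punchOut t≢u) (solves sol (punchOut t≢u)))

-- A homogeneous system with more unknowns than equations has a nontrivial
-- solution; induction on the number of unknowns, eliminating the first one.
underdetermined : ∀ {b m} → b < m → (P : Fin b → Fin m → ℚ) → NontrivialSolution P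
underdetermined {zero}  {suc m} _ P = first-unknown-free P (λ ())
underdetermined {suc b} {suc m} (s≤s b<m) P with all? (λ t → P t zero ℚP.≟ 0ℚ)
... | yes zero-column = first-unknown-free P zero-column
... | no ¬zero-column =
  let (t , pivot≢0) = ¬∀⟶∃¬ _ _ (λ t → P t zero ℚP.≟ 0ℚ) ¬zero-column
  in pivot-step P t pivot≢0
       (underdetermined b<m (λ s → Elimination.reduced P t (punchIn t s)))

-- If A = Y X with Y a v×b and X a b×v matrix over ℚ, then A has at most b
-- independent columns: a nontrivial dependence among more than b columns
-- of X is also a dependence among the same columns of A.
factored-rank-bound : ∀ {v b} (A : Matrix v)
  (Y : Fin v → Fin b → ℚ) (X : Fin b → Fin v → ℚ) →
  (∀ i j → toℚ (A i j) ≡ ∑[ t < b ] (Y i t * X t j)) →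
  ∀ {m} (cols : Fin m → Fin v) → IndepCols A cols → m ≤ b
factored-rank-bound {b = b} A Y X factors {m} cols (_ , independent)
  with m ℕP.≤? b
... | yes m≤b = m≤b
... | no m≰b = contradiction (independent c dependence (witness sol)) (witness≢0 sol)
  where
  sol = underdetermined (ℕP.≰⇒> m≰b) (λ t j → X t (cols j))
  c = coeffs sol
  regroup : ∀ c y x → c * (y * x) ≡ y * (c * x)
  regroup = RingSolver.solve-∀ ℚ-ring
  dependence : ∀ i → Σ[ (λ j → c j * toℚ (A i (cols j))) ] ≡ 0ℚ
  dependence i = begin
    Σ[ (λ j → c j * toℚ (A i (cols j))) ]
      ≡⟨ Σ≡sum (λ j → c j * toℚ (A i (cols j))) ⟩
    ∑[ j < m ] (c j * toℚ (A i (cols j)))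
      ≡⟨ sum-cong-≗ (λ j → trans (cong (c j *_) (factors i (cols j)))
                                 (*-distribˡ-sum (c j) (λ t → Y i t * X t (cols j)))) ⟩
    ∑[ j < m ] ∑[ t < b ] (c j * (Y i t * X t (cols j)))
      ≡⟨ ∑-comm (λ j t → c j * (Y i t * X t (cols j))) ⟩
    ∑[ t < b ] ∑[ j < m ] (c j * (Y i t * X t (cols j)))
      ≡⟨ sum-cong-≗ (λ t → trans (sum-cong-≗ (λ j → regroup (c j) (Y i t) (X t (cols j))))
                                 (sym (*-distribˡ-sum (Y i t) (λ j → c j * X t (cols j))))) ⟩
    ∑[ t < b ] (Y i t * ∑[ j < m ] (c j * X t (cols j)))
      ≡⟨ sum-cong-≗ (λ t → trans (cong (Y i t *_) (solves sol t)) (ℚP.*-zeroʳ (Y i t))) ⟩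
    sum (replicate b 0ℚ)
      ≡⟨ sum-replicate-zero b ⟩
    0ℚ ∎
    where open ≡-Reasoning

-- toℚ (+ n) is n/1; it sends successor to adding 1, checked on the
-- unnormalised rationals where n/1 is literally the pair (n, 1).
toℚ-suc : ∀ n → toℚ (+ suc n) ≡ 1ℚ + toℚ (+ n)
toℚ-suc n = ℚP.toℚᵘ-injective (begin
  toℚᵘ (toℚ (+ suc n))          ≈⟨ ℚP.toℚᵘ-fromℚᵘ (ℚᵘ.mkℚᵘ (+ suc n) 0) ⟩
  ℚᵘ.mkℚᵘ (+ suc n) 0           ≈⟨ ℚᵘ.*≡* (one-plus (+ n)) ⟩
  ℚᵘ.1ℚᵘ ℚᵘ.+ ℚᵘ.mkℚᵘ (+ n) 0  ≈⟨ ℚᵘP.+-congʳ ℚᵘ.1ℚᵘ (ℚP.toℚᵘ-fromℚᵘ (ℚᵘ.mkℚᵘ (+ n) 0)) ⟨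
  ℚᵘ.1ℚᵘ ℚᵘ.+ toℚᵘ (toℚ (+ n)) ≈⟨ ℚP.toℚᵘ-homo-+ 1ℚ (toℚ (+ n)) ⟨
  toℚᵘ (1ℚ + toℚ (+ n))         ∎)
  where
  open ℚᵘP.≃-Reasoning
  one-plus : ∀ (x : ℤ) → (+ 1 ℤ.+ x) ℤ.* + 1 ≡ (+ 1 ℤ.* + 1 ℤ.+ x ℤ.* + 1) ℤ.* + 1
  one-plus = solve-∀

indicator : Bool → ℚ
indicator true  = 1ℚ
indicator false = 0ℚ

indicator-∧ : ∀ x y → indicator (x ∧ y) ≡ indicator x * indicator y
indicator-∧ true  y = sym (ℚP.*-identityˡ (indicator y))
indicator-∧ false y = sym (ℚP.*-zeroˡ (indicator y))

count-as-sum : ∀ {v} (p : Subset v → Bool) (B : List (Subset v)) →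
  toℚ (+ count p B) ≡ ∑[ t < length B ] indicator (p (List.lookup B t))
count-as-sum p []      = refl
count-as-sum p (b ∷ B) =
  trans (count-step (p b) (count p B)) (cong (λ s → indicator (p b) + s) (count-as-sum p B))
  where
  count-step : ∀ x n → toℚ (+ (if x then suc n else n)) ≡ indicator x + toℚ (+ n)
  count-step true  n = toℚ-suc n
  count-step false n = sym (ℚP.+-identityˡ (toℚ (+ n)))

incidence : ∀ {v} (B : List (Subset v)) → Fin (length B) → Fin v → ℚ
incidence B t u = indicator (lookup (List.lookup B t) u)

rep₂-as-sum : ∀ {v} (B : List (Subset v)) u w →
  toℚ (+ rep₂ B u w) ≡ ∑[ t < length B ] (incidence B t u * incidence B t w)
rep₂-as-sum B u w = trans (count-as-sum (λ b → lookup b u ∧ lookup b w) B)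
  (sum-cong-≗ (λ t → indicator-∧ (lookup (List.lookup B t) u) (lookup (List.lookup B t) w)))

rep≡rep₂ : ∀ {v} (B : List (Subset v)) u → rep B u ≡ rep₂ B u u
rep≡rep₂ []      u = refl
rep≡rep₂ (b ∷ B) u rewrite ∧-idem (lookup b u) | rep≡rep₂ B u = refl

-- On the diagonal A(G) vanishes and λJ cancels the -λ of R.
diagonal-entry-covering : ∀ (x l : ℤ) → ((x ℤ.- l) ℤ.+ + 0) ℤ.+ l ≡ x
diagonal-entry-covering = solve-∀

diagonal-entry-packing : ∀ (x l : ℤ) → ((x ℤ.- l) ℤ.- + 0) ℤ.+ l ≡ x
diagonal-entry-packing = solve-∀

-- Off the diagonal of a covering, r ≥ λ, so μ = r - λ and μ + λ = r.
covering-entry : ∀ {r l} → l ≤ r → + ℤ.∣ + r ℤ.- + l ∣ ℤ.+ + l ≡ + r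
covering-entry {r} {l} l≤r = begin
  + ℤ.∣ + r ℤ.- + l ∣ ℤ.+ + l  ≡⟨ cong (λ n → + n ℤ.+ + l) (ℤP.∣i-j∣≡∣j-i∣ (+ r) (+ l)) ⟩
  + ℤ.∣ + l ℤ.- + r ∣ ℤ.+ + l  ≡⟨ cong (ℤ._+ + l) (ℤP.∣-∣-≤ (+≤+ l≤r)) ⟩
  (+ r ℤ.- + l) ℤ.+ + l        ≡⟨ sub-add (+ r) (+ l) ⟩
  + r                          ∎
  where
  open ≡-Reasoning
  sub-add : ∀ (x y : ℤ) → (x ℤ.- y) ℤ.+ y ≡ x
  sub-add = solve-∀

-- Off the diagonal of a packing, r ≤ λ, so μ = λ - r and -μ + λ = r.
packing-entry : ∀ {r l} → r ≤ l → (+ 0 ℤ.- + ℤ.∣ + r ℤ.- + l ∣) ℤ.+ + l ≡ + r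
packing-entry {r} {l} r≤l = begin
  (+ 0 ℤ.- + ℤ.∣ + r ℤ.- + l ∣) ℤ.+ + l
    ≡⟨ cong (λ n → (+ 0 ℤ.- n) ℤ.+ + l) (ℤP.∣-∣-≤ (+≤+ r≤l)) ⟩
  (+ 0 ℤ.- (+ l ℤ.- + r)) ℤ.+ + l
    ≡⟨ sub-sub (+ r) (+ l) ⟩
  + r ∎
  where
  open ≡-Reasoning
  sub-sub : ∀ (x y : ℤ) → (+ 0 ℤ.- (y ℤ.- x)) ℤ.+ y ≡ x
  sub-sub = solve-∀

Mstar≡rep₂ : ∀ K {v k lam} (B : List (Subset v)) → IsDesign K v k lam B →
  ∀ u w → Mstar K lam B u w ≡ + rep₂ B u w
Mstar≡rep₂ covering {lam = lam} B (_ , covers) u w with u ≟ w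
... | yes refl = trans (diagonal-entry-covering (+ rep B u) (+ lam)) (cong +_ (rep≡rep₂ B u))
... | no u≢w   = covering-entry (covers u w u≢w)
Mstar≡rep₂ packing  {lam = lam} B (_ , packs) u w with u ≟ w
... | yes refl = trans (diagonal-entry-packing (+ rep B u) (+ lam)) (cong +_ (rep≡rep₂ B u))
... | no u≢w   = packing-entry (packs u w u≢w)

Mstar-gram : ∀ K {v k lam} (B : List (Subset v)) → IsDesign K v k lam B →
  ∀ u w → toℚ (Mstar K lam B u w) ≡ ∑[ t < length B ] (incidence B t u * incidence B t w)
Mstar-gram K B design u w = trans (cong toℚ (Mstar≡rep₂ K B design u w)) (rep₂-as-sum B u w)

lemma2p1 : (K : Kind) (v k lam : ℕ) (B : List (Subset v)) →
    IsDesign K v k lam B →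
    (r : ℕ) → IsRank (Mstar K lam B) r → r ≤ length B
lemma2p1 K v k lam B design r ((cols , independent) , _) =
  factored-rank-bound (Mstar K lam B) (λ u t → incidence B t u) (incidence B)
    (Mstar-gram K B design) cols independent
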